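{- Let $n$ be an even half-Zumkeller number with prime factorization $n=p_1^{k_1}p_2^{k_2}\cdots p_m^{k_m}$. Then for any positive integers $l_1,\ldots,l_m$, the number $$p_1^{k_1+l_1(k_1+1)}p_2^{k_2+l_2(k_2+1)}\cdots p_m^{k_m+l_m(k_m+1)}$$ is a half-Zumkeller number.
   Context: A positive integer $n$ is a half-Zumkeller number if the set of all positive divisors of $n$ other than $n$ itself can be partitioned into two disjoint parts whose sums are equal. -}

module Defs where

open import Data.Nat using (ℕ; zero; suc; _*_; _≤?_)
open import Data.Nat.Divisibility using (_∣?_)
open import Data.Nat.ListAction using (sum)
open import Data.List using (List; filter; upTo; _++_)
open import Data.List.Relation.Binary.Permutation.Propositional using (_↭_)
open import Data.Fin as Fin using (Fin)
open import Data.Product using (∃₂; _×_)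
open import Relation.Binary.PropositionalEquality using (_≡_)

properDivisors : ℕ → List ℕ
properDivisors n = filter (_∣? n) (filter (1 ≤?_) (upTo n))

-- n is half-Zumkeller: the proper divisors can be partitioned into two
-- disjoint parts A and B (A ++ B is a permutation of the list of proper
-- divisors, so every proper divisor lies in exactly one part) with equal sums.
HalfZumkeller : ℕ → Set
HalfZumkeller n = ∃₂ λ (A B : List ℕ) → (A ++ B ↭ properDivisors n) × (sum A ≡ sum B)

∏ : (m : ℕ) → (Fin m → ℕ) → ℕ
∏ zero    f = 1
∏ (suc m) f = f Fin.zero * ∏ m (λ i → f (Fin.suc i))

module Submission where

-- The argument then has three steps:
--  * If n = 2h is half-Zumkeller, then h is a proper divisor; moving h to
--    the other part and adding n to its own part splits the list of ALL
--    divisors n ∷ properDivisors n (n is Zumkeller).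
--  * For a prime q, q ∤ r, n = q^k r and c = q^(k+1), the proper divisors of
--    c · q^(k+a) r are the divisors of n (those not divisible by c) followed
--    by c times the proper divisors of q^(k+a) r.  Hence one multiplication
--    by c preserves being half-Zumkeller, and induction on l raises the
--    exponent of q to k + l(k+1).
--  * The primes of n are raised one at a time; the part already raised is
--    carried as a cofactor prime to the remaining primes, and evenness is
--    preserved.

open import Defs
open import Data.Nat using (ℕ; suc; _+_; _*_; _^_; _≤_; _≥_)
open import Data.Nat.Divisibility using (_∣_)
open import Data.Nat.Primality using (Prime)
open import Data.Fin using (Fin)
open import Function.Definitions using (Injective)
open import Relation.Binary.PropositionalEquality using (_≡_)

open import Data.Nat using (zero; _<_; _≟_; _≤?_; s≤s; z≤n; NonZero; >-nonZero; >-nonZero⁻¹)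
open import Data.Nat.Properties
  using (*-identityˡ; *-identityʳ; +-identityʳ; *-assoc; *-comm; *-zeroʳ; *-distribˡ-+;
         *-cancelˡ-≡; *-cancelˡ-<; *-monoʳ-<; m<m*n; m≤m*n; m≤n*m; m^n≢0; m*n≢0; m*n≢0⇒m≢0;
         ^-distribˡ-+-*; ≤-trans; <-≤-trans; ≤-<-trans; <-trans; <-irrefl; ≤∧≢⇒<;
         *-commutativeSemigroup)
open import Data.Nat.Divisibility
  using (divides; _∣?_; _∣0; ∣-refl; ∣-trans; ∣⇒≤; ∣1⇒≡1; m∣m*n; n∣m*n; ∣n⇒∣m*n;
         *-pres-∣; *-monoʳ-∣; *-cancelˡ-∣)
open import Data.Nat.Primality
  using (euclidsLemma; prime⇒irreducible; prime⇒nonZero; prime⇒nonTrivial; ¬prime[1])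
open import Data.Nat.Base using (nonTrivial⇒n>1)
open import Data.Nat.Coprimality using (Coprime; coprime-divisor)
open import Data.Nat.ListAction using (sum)
open import Data.Nat.ListAction.Properties using (sum-++; sum-↭)
open import Data.Nat.Tactic.RingSolver using (solve-∀)
open import Algebra.Properties.CommutativeSemigroup *-commutativeSemigroup using (x∙yz≈y∙xz)
open import Data.Fin using (zero; suc)
open import Data.Fin.Properties using (suc-injective)
open import Data.List using (List; []; _∷_; _++_; map; [_])
open import Data.List.Properties using (map-++; ++-assoc)
open import Data.List.Membership.Propositional using (_∈_)
open import Data.List.Membership.Propositional.Properties
  using (∈-filter⁺; ∈-filter⁻; ∈-upTo⁺; ∈-upTo⁻; ∈-++⁺ˡ; ∈-++⁺ʳ; ∈-++⁻; ∈-map⁺; ∈-map⁻; ∈-∃++)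
open import Data.List.Membership.Propositional.Properties.WithK using (unique∧set⇒bag)
open import Data.List.Relation.Unary.All using (tabulate)
open import Data.List.Relation.Unary.AllPairs using (_∷_)
open import Data.List.Relation.Unary.Any using (here; there)
open import Data.List.Relation.Unary.Unique.Propositional using (Unique)
import Data.List.Relation.Unary.Unique.Propositional.Properties as Unique
open import Data.List.Relation.Binary.BagAndSetEquality using (∼bag⇒↭)
open import Data.List.Relation.Binary.Permutation.Propositional
  using (_↭_; prep; ↭-sym; ↭-trans; ↭-reflexive; module PermutationReasoning)
open import Data.List.Relation.Binary.Permutation.Propositional.Properties
  using (++⁺; ++⁺ˡ; ++-comm; shift; shifts; map⁺; ∈-resp-↭)
open import Data.Product using (_×_; _,_; proj₁; proj₂; ∃₂)
open import Data.Sum using (inj₁; inj₂)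
open import Data.Empty using (⊥-elim)
open import Function.Bundles using (mk⇔)
open import Relation.Nullary using (¬_; yes; no)
open import Relation.Binary.PropositionalEquality
  using (_≢_; refl; sym; trans; cong; cong₂; subst; subst₂; module ≡-Reasoning)

EqualSplit : List ℕ → Set
EqualSplit xs = ∃₂ λ (A B : List ℕ) → (A ++ B ↭ xs) × (sum A ≡ sum B)

split-↭ : {xs ys : List ℕ} → xs ↭ ys → EqualSplit xs → EqualSplit ys
split-↭ xs↭ys (A , B , A++B↭xs , eq) = A , B , ↭-trans A++B↭xs xs↭ys , eq

split-++ : {xs ys : List ℕ} → EqualSplit xs → EqualSplit ys → EqualSplit (xs ++ ys)
split-++ {xs} {ys} (A , B , A++B↭xs , eqAB) (C , D , C++D↭ys , eqCD) =
  A ++ C , B ++ D , regroup , sums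
  where
  open PermutationReasoning
  regroup : (A ++ C) ++ (B ++ D) ↭ xs ++ ys
  regroup = begin
    (A ++ C) ++ (B ++ D)  ≡⟨ ++-assoc A C (B ++ D) ⟩
    A ++ (C ++ (B ++ D))  ↭⟨ ++⁺ˡ A (shifts C B) ⟩
    A ++ (B ++ (C ++ D))  ≡⟨ ++-assoc A B (C ++ D) ⟨
    (A ++ B) ++ (C ++ D)  ↭⟨ ++⁺ A++B↭xs C++D↭ys ⟩
    xs ++ ys              ∎
  sums : sum (A ++ C) ≡ sum (B ++ D)
  sums = trans (sum-++ A C) (trans (cong₂ _+_ eqAB eqCD) (sym (sum-++ B D)))

sum-scale : ∀ c xs → sum (map (c *_) xs) ≡ c * sum xs
sum-scale c []       = sym (*-zeroʳ c)
sum-scale c (x ∷ xs) = trans (cong (c * x +_) (sum-scale c xs)) (sym (*-distribˡ-+ c x (sum xs)))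

split-scale : ∀ c {xs} → EqualSplit xs → EqualSplit (map (c *_) xs)
split-scale c (A , B , A++B↭xs , eq) =
  map (c *_) A , map (c *_) B ,
  ↭-trans (↭-reflexive (sym (map-++ (c *_) A B))) (map⁺ (c *_) A++B↭xs) ,
  trans (sum-scale c A) (trans (cong (c *_) eq) (sym (sum-scale c B)))

-- If h lies in the second part of a split of xs, then h·2 ∷ xs splits as
-- (h·2 ∷ B∖h) ∪ (h ∷ A): both parts sum to h + sum A.
split-double-right : ∀ {xs h} (A B : List ℕ) → A ++ B ↭ xs → sum A ≡ sum B → h ∈ B →
                     EqualSplit (h * 2 ∷ xs)
split-double-right {xs} {h} A B A++B↭xs eq h∈B with B₁ , B₂ , refl ← ∈-∃++ h∈B =
  h * 2 ∷ B′ , h ∷ A , prep (h * 2) regroup , sums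
  where
  B′ : List ℕ
  B′ = B₁ ++ B₂
  B↭h∷B′ : B₁ ++ [ h ] ++ B₂ ↭ h ∷ B′
  B↭h∷B′ = shift h B₁ B₂
  regroup : B′ ++ h ∷ A ↭ xs
  regroup = begin
    B′ ++ h ∷ A   ↭⟨ shift h B′ A ⟩
    h ∷ B′ ++ A   ↭⟨ ++-comm (h ∷ B′) A ⟩
    A ++ h ∷ B′   ↭⟨ ++⁺ˡ A (↭-sym B↭h∷B′) ⟩
    A ++ B        ↭⟨ A++B↭xs ⟩
    xs            ∎
    where open PermutationReasoning
  sums : h * 2 + sum B′ ≡ h + sum A
  sums = begin
    h * 2 + sum B′      ≡⟨ double h (sum B′) ⟩
    h + (h + sum B′)    ≡⟨ cong (h +_) (sum-↭ B↭h∷B′) ⟨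
    h + sum B           ≡⟨ cong (h +_) eq ⟨
    h + sum A           ∎
    where
    open ≡-Reasoning
    double : ∀ x s → x * 2 + s ≡ x + (x + s)
    double = solve-∀

split-double : ∀ {xs h} → EqualSplit xs → h ∈ xs → EqualSplit (h * 2 ∷ xs)
split-double (A , B , A++B↭xs , eq) h∈xs with ∈-++⁻ A (∈-resp-↭ (↭-sym A++B↭xs) h∈xs)
... | inj₂ h∈B = split-double-right A B A++B↭xs eq h∈B
... | inj₁ h∈A = split-double-right B A (↭-trans (++-comm B A) A++B↭xs) (sym eq) h∈A

∈-properDivisors⁻ : ∀ {x n} → x ∈ properDivisors n → 1 ≤ x × x ∣ n × x < n
∈-properDivisors⁻ {x} {n} x∈ with x∈′ , x∣n ← ∈-filter⁻ (_∣? n) x∈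
                             with x∈upTo , 1≤x ← ∈-filter⁻ (1 ≤?_) x∈′ =
  1≤x , x∣n , ∈-upTo⁻ x∈upTo

∈-properDivisors⁺ : ∀ {x n} → 1 ≤ x → x ∣ n → x < n → x ∈ properDivisors n
∈-properDivisors⁺ {x} {n} 1≤x x∣n x<n = ∈-filter⁺ (_∣? n) (∈-filter⁺ (1 ≤?_) (∈-upTo⁺ x<n) 1≤x) x∣n

properDivisors-unique : ∀ n → Unique (properDivisors n)
properDivisors-unique n = Unique.filter⁺ (_∣? n) (Unique.filter⁺ (1 ≤?_) (Unique.upTo⁺ n))

unique-↭ : {A : Set} {xs ys : List A} → Unique xs → Unique ys →
           (∀ {x} → x ∈ xs → x ∈ ys) → (∀ {x} → x ∈ ys → x ∈ xs) → xs ↭ ys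
unique-↭ xs-unique ys-unique xs⊆ys ys⊆xs =
  ∼bag⇒↭ (unique∧set⇒bag xs-unique ys-unique (mk⇔ xs⊆ys ys⊆xs))

-- An even half-Zumkeller number n = h·2 is Zumkeller: h is a proper divisor,
-- so split-double extends the split of the proper divisors by n itself.
zumkeller-of-even : ∀ n → .{{NonZero n}} → 2 ∣ n → HalfZumkeller n →
                    EqualSplit (n ∷ properDivisors n)
zumkeller-of-even n (divides h refl) hz =
  split-double hz (∈-properDivisors⁺ 1≤h (divides 2 (*-comm h 2)) (m<m*n h 2 (s≤s (s≤s z≤n))))
  where
  instance
    h≢0 : NonZero h
    h≢0 = m*n≢0⇒m≢0 h
  1≤h : 1 ≤ h
  1≤h = >-nonZero⁻¹ h

prime∤⇒coprime : ∀ {q e} → Prime q → ¬ q ∣ e → Coprime e q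
prime∤⇒coprime q-prime q∤e (d∣e , d∣q) with prime⇒irreducible q-prime d∣q
... | inj₁ d≡1 = d≡1
... | inj₂ refl = ⊥-elim (q∤e d∣e)

∣-strip-power : ∀ {q e} → Prime q → ¬ q ∣ e → ∀ a r → e ∣ q ^ a * r → e ∣ r
∣-strip-power {e = e} q-prime q∤e zero r e∣ = subst (e ∣_) (*-identityˡ r) e∣
∣-strip-power {q} {e} q-prime q∤e (suc a) r e∣ =
  ∣-strip-power q-prime q∤e a r
    (coprime-divisor (prime∤⇒coprime q-prime q∤e) (subst (e ∣_) (*-assoc q (q ^ a) r) e∣))

-- A divisor of q^(k+a) · r not divisible by q^(k+1) already divides q^k · r.
-- Induction on k, cancelling one factor q from e while q ∣ e.
∣-low-power : ∀ {q r} → Prime q → ∀ k a e → e ∣ q ^ (k + a) * r → ¬ q ^ suc k ∣ e →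
              e ∣ q ^ k * r
∣-low-power {q} {r} q-prime zero a e e∣ q∤e =
  subst (e ∣_) (sym (*-identityˡ r))
    (∣-strip-power q-prime (λ q∣e → q∤e (subst (_∣ e) (sym (*-identityʳ q)) q∣e)) a r e∣)
∣-low-power {q} {r} q-prime (suc k) a e e∣ qᵏ⁺²∤e with q ∣? e
... | no q∤e = ∣n⇒∣m*n (q ^ suc k) (∣-strip-power q-prime q∤e (suc k + a) r e∣)
... | yes (divides e′ refl) =
  subst₂ _∣_ (*-comm q e′) (sym (*-assoc q (q ^ k) r)) (*-monoʳ-∣ q e′∣qᵏr)
  where
  instance
    q≢0 : NonZero q
    q≢0 = prime⇒nonZero q-prime
  qᵏ⁺¹∤e′ : ¬ q ^ suc k ∣ e′
  qᵏ⁺¹∤e′ qᵏ⁺¹∣e′ = qᵏ⁺²∤e (subst (_∣ e′ * q) (*-comm (q ^ suc k) q) (*-pres-∣ qᵏ⁺¹∣e′ (∣-refl {q})))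
  e′∣qᵏr : e′ ∣ q ^ k * r
  e′∣qᵏr = ∣-low-power q-prime k a e′
    (*-cancelˡ-∣ q (subst₂ _∣_ (*-comm e′ q) (*-assoc q (q ^ (k + a)) r) e∣)) qᵏ⁺¹∤e′

prime∤* : ∀ {q x y} → Prime q → ¬ q ∣ x → ¬ q ∣ y → ¬ q ∣ x * y
prime∤* {x = x} {y} q-prime q∤x q∤y q∣xy with euclidsLemma x y q-prime q∣xy
... | inj₁ q∣x = q∤x q∣x
... | inj₂ q∣y = q∤y q∣y

prime∤1 : ∀ {q} → Prime q → ¬ q ∣ 1
prime∤1 q-prime q∣1 with ∣1⇒≡1 q∣1
... | refl = ¬prime[1] q-prime

prime∤prime-power : ∀ {q p} → Prime q → Prime p → q ≢ p → ∀ e → ¬ q ∣ p ^ e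
prime∤prime-power q-prime p-prime q≢p zero = prime∤1 q-prime
prime∤prime-power {q} {p} q-prime p-prime q≢p (suc e) =
  prime∤* q-prime q∤p (prime∤prime-power q-prime p-prime q≢p e)
  where
  q∤p : ¬ q ∣ p
  q∤p q∣p with prime⇒irreducible p-prime q∣p
  ... | inj₁ refl = ¬prime[1] q-prime
  ... | inj₂ q≡p = q≢p q≡p

prime∤∏ : ∀ {q} → Prime q → ∀ m (f : Fin m → ℕ) → (∀ i → ¬ q ∣ f i) → ¬ q ∣ ∏ m f
prime∤∏ q-prime zero    f q∤f = prime∤1 q-prime
prime∤∏ q-prime (suc m) f q∤f =
  prime∤* q-prime (q∤f zero) (prime∤∏ q-prime m (λ i → f (suc i)) (λ i → q∤f (suc i)))

∤⇒nonZero : ∀ {q} r → ¬ q ∣ r → NonZero r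
∤⇒nonZero {q} zero    q∤0 = ⊥-elim (q∤0 (q ∣0))
∤⇒nonZero     (suc r) _   = _

power-∣ : ∀ q k a r → q ^ k * r ∣ q ^ (k + a) * r
power-∣ q k a r = divides (q ^ a) (begin
  q ^ (k + a) * r       ≡⟨ cong (_* r) (^-distribˡ-+-* q k a) ⟩
  q ^ k * q ^ a * r     ≡⟨ cong (_* r) (*-comm (q ^ k) (q ^ a)) ⟩
  q ^ a * q ^ k * r     ≡⟨ *-assoc (q ^ a) (q ^ k) r ⟩
  q ^ a * (q ^ k * r)   ∎)
  where open ≡-Reasoning

power-shift : ∀ q k a r → q ^ suc k * (q ^ (k + a) * r) ≡ q ^ (k + (suc k + a)) * r
power-shift q k a r = begin
  q ^ suc k * (q ^ (k + a) * r)   ≡⟨ *-assoc (q ^ suc k) (q ^ (k + a)) r ⟨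
  q ^ suc k * q ^ (k + a) * r     ≡⟨ cong (_* r) (^-distribˡ-+-* q (suc k) (k + a)) ⟨
  q ^ (suc k + (k + a)) * r       ≡⟨ cong (λ e → q ^ e * r) (exponents k a) ⟩
  q ^ (k + (suc k + a)) * r       ∎
  where
  open ≡-Reasoning
  exponents : ∀ k a → suc k + (k + a) ≡ k + (suc k + a)
  exponents = solve-∀

module RaisePrime (q k r : ℕ) (q-prime : Prime q) (q∤r : ¬ q ∣ r) where

  n c : ℕ
  n = q ^ k * r
  c = q ^ suc k

  M : ℕ → ℕ
  M a = q ^ (k + a) * r

  instance
    q≢0 : NonZero q
    q≢0 = prime⇒nonZero q-prime
    r≢0 : NonZero r
    r≢0 = ∤⇒nonZero r q∤r
    c≢0 : NonZero c
    c≢0 = m^n≢0 q (suc k)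
    qᵏ≢0 : NonZero (q ^ k)
    qᵏ≢0 = m^n≢0 q k
    n≢0 : NonZero n
    n≢0 = m*n≢0 (q ^ k) r
    M≢0 : ∀ {a} → NonZero (M a)
    M≢0 {a} = m*n≢0 (q ^ (k + a)) r {{m^n≢0 q (k + a)}}

  c∤n : ¬ c ∣ n
  c∤n c∣n = q∤r (*-cancelˡ-∣ (q ^ k) (subst (_∣ n) (*-comm q (q ^ k)) c∣n))

  n<cM : ∀ a → n < c * M a
  n<cM a = ≤-<-trans (∣⇒≤ (power-∣ q k a r)) M<cM
    where
    1<c : 1 < c
    1<c = <-≤-trans (nonTrivial⇒n>1 q {{prime⇒nonTrivial q-prime}}) (m≤m*n q (q ^ k))
    M<cM : M a < c * M a
    M<cM = subst (M a <_) (*-comm (M a) c) (m<m*n (M a) c 1<c)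

  Decomposition : ℕ → List ℕ
  Decomposition a = (n ∷ properDivisors n) ++ map (c *_) (properDivisors (M a))

  decomposition-⊇ : ∀ a {x} → x ∈ properDivisors (c * M a) → x ∈ Decomposition a
  decomposition-⊇ a {x} x∈ with ∈-properDivisors⁻ x∈
  ... | 1≤x , x∣cM , x<cM with c ∣? x
  ...   | yes (divides y refl) =
          ∈-++⁺ʳ (n ∷ properDivisors n)
            (subst (_∈ map (c *_) (properDivisors (M a))) (*-comm c y)
              (∈-map⁺ (c *_) (∈-properDivisors⁺ 1≤y y∣M y<M)))
    where
    y∣M : y ∣ M a
    y∣M = *-cancelˡ-∣ c (subst (_∣ c * M a) (*-comm y c) x∣cM)
    y<M : y < M a
    y<M = *-cancelˡ-< c y (M a) (subst (_< c * M a) (*-comm y c) x<cM)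
    1≤y : 1 ≤ y
    1≤y = >-nonZero⁻¹ y {{m*n≢0⇒m≢0 y {{>-nonZero 1≤x}}}}
  ...   | no c∤x with x ≟ n
  ...     | yes refl = here refl
  ...     | no x≢n = there (∈-++⁺ˡ (∈-properDivisors⁺ 1≤x x∣n (≤∧≢⇒< (∣⇒≤ x∣n) x≢n)))
    where
    x∣n : x ∣ n
    x∣n = ∣-low-power q-prime k (suc k + a) x (subst (x ∣_) (power-shift q k a r) x∣cM) c∤x

  decomposition-⊆ : ∀ a {x} → x ∈ Decomposition a → x ∈ properDivisors (c * M a)
  decomposition-⊆ a {x} x∈ with ∈-++⁻ (n ∷ properDivisors n) x∈
  ... | inj₁ (here refl) =
          ∈-properDivisors⁺ (>-nonZero⁻¹ n) (∣-trans (power-∣ q k a r) (n∣m*n c)) (n<cM a)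
  ... | inj₁ (there x∈pd) with 1≤x , x∣n , x<n ← ∈-properDivisors⁻ x∈pd =
          ∈-properDivisors⁺ 1≤x (∣-trans x∣n (∣-trans (power-∣ q k a r) (n∣m*n c)))
            (<-trans x<n (n<cM a))
  ... | inj₂ x∈cpd with y , y∈pd , refl ← ∈-map⁻ (c *_) x∈cpd
                   with 1≤y , y∣M , y<M ← ∈-properDivisors⁻ y∈pd =
          ∈-properDivisors⁺ (≤-trans 1≤y (m≤n*m y c)) (*-monoʳ-∣ c y∣M) (*-monoʳ-< c y<M)

  -- The decomposition has no repetitions: n is not a proper divisor of n,
  -- and no multiple of c divides n.
  decomposition-unique : ∀ a → Unique (Decomposition a)
  decomposition-unique a =
    tabulate n∉ ∷ Unique.++⁺ (properDivisors-unique n)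
                    (Unique.map⁺ (λ {x} {y} → *-cancelˡ-≡ x y c) (properDivisors-unique (M a)))
                    disjoint
    where
    n∉ : ∀ {x} → x ∈ properDivisors n ++ map (c *_) (properDivisors (M a)) → n ≢ x
    n∉ x∈ n≡x with ∈-++⁻ (properDivisors n) x∈
    ... | inj₁ x∈pd = <-irrefl (sym n≡x) (proj₂ (proj₂ (∈-properDivisors⁻ x∈pd)))
    ... | inj₂ x∈cpd with y , _ , refl ← ∈-map⁻ (c *_) x∈cpd = c∤n (subst (c ∣_) (sym n≡x) (m∣m*n y))
    disjoint : ∀ {x} → ¬ (x ∈ properDivisors n × x ∈ map (c *_) (properDivisors (M a)))
    disjoint (x∈pd , x∈cpd) with y , _ , refl ← ∈-map⁻ (c *_) x∈cpd =
      c∤n (∣-trans (m∣m*n y) (proj₁ (proj₂ (∈-properDivisors⁻ x∈pd))))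

  properDivisors-decomposition : ∀ a → properDivisors (c * M a) ↭ Decomposition a
  properDivisors-decomposition a =
    unique-↭ (properDivisors-unique (c * M a)) (decomposition-unique a)
      (decomposition-⊇ a) (decomposition-⊆ a)

  halfZumkeller-step : EqualSplit (n ∷ properDivisors n) → ∀ a →
                       HalfZumkeller (M a) → HalfZumkeller (c * M a)
  halfZumkeller-step divisors-split a hz =
    split-↭ (↭-sym (properDivisors-decomposition a)) (split-++ divisors-split (split-scale c hz))

  halfZumkeller-raise : 2 ∣ n → HalfZumkeller n → ∀ l → HalfZumkeller (M (l * suc k))
  halfZumkeller-raise 2∣n hz zero =
    subst HalfZumkeller (cong (λ e → q ^ e * r) (sym (+-identityʳ k))) hz
  halfZumkeller-raise 2∣n hz (suc l) =
    subst HalfZumkeller (power-shift q k (l * suc k) r)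
      (halfZumkeller-step (zumkeller-of-even n 2∣n hz) (l * suc k) (halfZumkeller-raise 2∣n hz l))

-- Raising all primes of a factorisation, one at a time.  The cofactor c is
-- the part already raised; it is prime to the remaining primes p i.
halfZumkeller-raise-all :
  ∀ m (p k l : Fin m → ℕ) (c : ℕ) → (∀ i → Prime (p i)) → Injective _≡_ _≡_ p →
  (∀ i → ¬ p i ∣ c) →
  2 ∣ c * ∏ m (λ i → p i ^ k i) → HalfZumkeller (c * ∏ m (λ i → p i ^ k i)) →
  HalfZumkeller (c * ∏ m (λ i → p i ^ (k i + l i * suc (k i))))
halfZumkeller-raise-all zero    p k l c p-prime p-inj p∤c 2∣n hz = hz
halfZumkeller-raise-all (suc m) p k l c p-prime p-inj p∤c 2∣n hz =
  subst HalfZumkeller (*-assoc c (p₀ ^ k₀′) R′)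
    (halfZumkeller-raise-all m (λ i → p (suc i)) (λ i → k (suc i)) (λ i → l (suc i)) (c * p₀ ^ k₀′)
      (λ i → p-prime (suc i)) (λ eq → suc-injective (p-inj eq)) p∤c′
      (subst (2 ∣_) regroup′ raised-even) (subst HalfZumkeller regroup′ raised))
  where
  p₀ k₀ k₀′ R R′ : ℕ
  p₀ = p zero
  k₀ = k zero
  k₀′ = k₀ + l zero * suc k₀
  R = ∏ m (λ i → p (suc i) ^ k (suc i))
  R′ = ∏ m (λ i → p (suc i) ^ (k (suc i) + l (suc i) * suc (k (suc i))))
  p₀≢p : ∀ i → p₀ ≢ p (suc i)
  p₀≢p i eq with p-inj eq
  ... | ()
  p₀∤cR : ¬ p₀ ∣ c * R
  p₀∤cR = prime∤* (p-prime zero) (p∤c zero)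
            (prime∤∏ (p-prime zero) m _ (λ i → prime∤prime-power (p-prime zero) (p-prime (suc i)) (p₀≢p i) (k (suc i))))
  p∤c′ : ∀ i → ¬ p (suc i) ∣ c * p₀ ^ k₀′
  p∤c′ i = prime∤* (p-prime (suc i)) (p∤c (suc i))
             (prime∤prime-power (p-prime (suc i)) (p-prime zero) (λ eq → p₀≢p i (sym eq)) k₀′)
  regroup : c * (p₀ ^ k₀ * R) ≡ p₀ ^ k₀ * (c * R)
  regroup = x∙yz≈y∙xz c (p₀ ^ k₀) R
  regroup′ : p₀ ^ k₀′ * (c * R) ≡ c * p₀ ^ k₀′ * R
  regroup′ = trans (x∙yz≈y∙xz (p₀ ^ k₀′) c R) (sym (*-assoc c (p₀ ^ k₀′) R))
  2∣n′ : 2 ∣ p₀ ^ k₀ * (c * R)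
  2∣n′ = subst (2 ∣_) regroup 2∣n
  raised : HalfZumkeller (p₀ ^ k₀′ * (c * R))
  raised = RaisePrime.halfZumkeller-raise p₀ k₀ (c * R) (p-prime zero) p₀∤cR
             2∣n′ (subst HalfZumkeller regroup hz) (l zero)
  raised-even : 2 ∣ p₀ ^ k₀′ * (c * R)
  raised-even = ∣-trans 2∣n′ (power-∣ p₀ k₀ (l zero * suc k₀) (c * R))

mainTheorem13 : (n : ℕ) → 1 ≤ n → 2 ∣ n → HalfZumkeller n →
    (m : ℕ) (p k : Fin m → ℕ) →
    (∀ i → Prime (p i)) → Injective _≡_ _≡_ p → (∀ i → k i ≥ 1) →
    n ≡ ∏ m (λ i → p i ^ k i) →
    (l : Fin m → ℕ) → (∀ i → l i ≥ 1) →
    HalfZumkeller (∏ m (λ i → p i ^ (k i + l i * suc (k i))))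
mainTheorem13 n _ 2∣n hz m p k p-prime p-inj _ n≡∏ l _ =
  subst HalfZumkeller (*-identityˡ (∏ m (λ i → p i ^ (k i + l i * suc (k i)))))
    (halfZumkeller-raise-all m p k l 1 p-prime p-inj (λ i → prime∤1 (p-prime i))
      (subst (2 ∣_) n≡1*∏ 2∣n) (subst HalfZumkeller n≡1*∏ hz))
  where
  n≡1*∏ : n ≡ 1 * ∏ m (λ i → p i ^ k i)
  n≡1*∏ = trans n≡∏ (sym (*-identityˡ _))
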